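{- There exists no finite set $\mathcal{S}$ of nonerasing endomorphisms of $\{a,b\}^*$ such that the set of Sturmian words is equal to $\mathrm{Stab}(\mathcal{S})$.
   Context: Infinite words are right infinite. A Sturmian word is an infinite word over $\{a,b\}$ that is balanced (for each letter $x$ and all factors $u,v$ with $|u|=|v|$, $||u|_x-|v|_x|\le1$) and not ultimately periodic. For a set $\mathcal{S}$ of nonerasing endomorphisms, $\mathrm{Stab}(\mathcal{S})$ is the set of infinite words $\mathbf{w}$ for which there exist $(\sigma_n)_{n\ge1}\in\mathcal{S}^\omega$ and infinite words $(\mathbf{w}_n)_{n\ge0}$ with $\mathbf{w}_0=\mathbf{w}$ and $\mathbf{w}_n=\sigma_{n+1}(\mathbf{w}_{n+1})$ for all $n\ge0$. -}

module Defs where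

open import Data.Nat using (ℕ; zero; suc; _+_; _≤_; _<_; ∣_-_∣)
open import Data.Fin using (Fin; toℕ)
open import Data.List using (List; []; _∷_; _++_; length; lookup)
open import Data.Product using (Σ; ∃; _×_)
open import Relation.Binary.PropositionalEquality using (_≡_)
open import Relation.Nullary using (¬_)
open import Function.Bundles using (_⇔_)

data Letter : Set where
  a b : Letter

Word : Set
Word = List Letter

InfWord : Set
InfWord = ℕ → Letter

eqInd : Letter → Letter → ℕ
eqInd a a = 1
eqInd b b = 1
eqInd a b = 0
eqInd b a = 0

-- Number of occurrences |u|_x of x in the factor u = w[i] w[i+1] … w[i+n-1].
countIn : Letter → InfWord → (i n : ℕ) → ℕ
countIn x w i zero = zero
countIn x w i (suc n) = countIn x w i n + eqInd x (w (i + n))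

Balanced : InfWord → Set
Balanced w = ∀ (x : Letter) (i j n : ℕ) → ∣ countIn x w i n - countIn x w j n ∣ ≤ 1

UltimatelyPeriodic : InfWord → Set
UltimatelyPeriodic w = Σ ℕ λ p → 0 < p × Σ ℕ λ N → ∀ i → N ≤ i → w (i + p) ≡ w i

Sturmian : InfWord → Set
Sturmian w = Balanced w × ¬ UltimatelyPeriodic w

-- Endomorphisms of {a,b}^* are determined by the images of the letters.
Morphism : Set
Morphism = Letter → Word

Nonerasing : Morphism → Set
Nonerasing σ = ∀ (x : Letter) → 0 < length (σ x)

applyW : Morphism → Word → Word
applyW σ [] = []
applyW σ (x ∷ u) = σ x ++ applyW σ u

prefixOf : InfWord → ℕ → Word
prefixOf v zero = []
prefixOf v (suc k) = v zero ∷ prefixOf (λ i → v (suc i)) k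

IsPrefix : Word → InfWord → Set
IsPrefix u w = ∀ (i : Fin (length u)) → lookup u i ≡ w (toℕ i)

-- w = σ(v) for an infinite word v: σ applied to every prefix of v is a
-- prefix of w.  For nonerasing σ this determines w uniquely.
IsImage : Morphism → InfWord → InfWord → Set
IsImage σ v w = ∀ (k : ℕ) → IsPrefix (applyW σ (prefixOf v k)) w

-- Stab(S): there exist (σ_n)_{n≥1} ∈ S^ω (σ_{n+1} = S (c n)) and infinite
-- words (w_n)_{n≥0} with w_0 = w and w_n = σ_{n+1}(w_{n+1}).
Stab : {k : ℕ} → (Fin k → Morphism) → InfWord → Set
Stab {k} S w =
  Σ (ℕ → Fin k) λ c →
  Σ (ℕ → InfWord) λ ws →
    (∀ i → ws zero i ≡ w i) ×
    (∀ n → IsImage (S (c n)) (ws (suc n)) (ws n))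

-- A Sturmian word w lies in Stab(S) only if w = σ(w') with σ ∈ S, so the first image σ(w' 0),
-- of length at most the maximal image length B of S, is a prefix of w. Sturmian words
-- beginning with an arbitrarily long run of a, resp. of b, exist: take the mechanical word of
-- slope (√2 - 1)/(M + 1), whose prefix counts ⌊(√2 - 1) n/(M + 1)⌋ are quasi-additive (so the
-- word is balanced) and are not linear along any arithmetic progression since √2 is
-- irrational. Hence S contains morphisms mapping some letter into a⁺ and some letter into b⁺,
-- and chaining them shows that the periodic word aaa… lies in Stab(S), which is absurd.
module Submission where

open import Defs
open import Data.Nat using (ℕ)
open import Data.Fin using (Fin)
open import Data.Product using (Σ; _×_)
open import Relation.Nullary using (¬_)
open import Function.Bundles using (_⇔_)

open import Data.Nat using (zero; suc; _+_; _*_; _≤_; _<_; _≤?_; _⊔_; ∣_-_∣; z≤n; s≤s)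
open import Data.Nat.Properties
open import Data.Nat.Divisibility using (_∣_; divides)
open import Data.Nat.Induction using (<-rec)
open import Data.Nat.Primality using (prime?; euclidsLemma)
open import Data.Nat.Tactic.RingSolver using (solve-∀)
open import Algebra.Properties.CommutativeSemigroup +-commutativeSemigroup using (interchange; xy∙z≈xz∙y)
open import Data.Fin using (zero; suc)
open import Data.List using ([]; _∷_; length)
open import Data.List.Properties using (++-identityʳ)
open import Data.List.Relation.Unary.All using (All; []; _∷_)
open import Data.List.Relation.Unary.All.Properties using (++⁺)
open import Data.Product using (_,_; proj₁; proj₂)
open import Data.Sum using (_⊎_; inj₁; inj₂; reduce)
open import Data.Empty using (⊥-elim)
open import Function using (_∘_)
open import Function.Bundles using (Equivalence)
open import Relation.Binary.Definitions using (tri<; tri≈; tri>)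
open import Relation.Binary.PropositionalEquality
  using (_≡_; refl; sym; trans; cong; cong₂; subst; module ≡-Reasoning)
open import Relation.Nullary using (Dec; yes; no)
open import Relation.Nullary.Decidable using (from-yes; map′)

-- x ≤ √2 y, squared so as to stay in ℕ; a record so that x and y can be inferred.
record _≤√2·_ (x y : ℕ) : Set where
  constructor mk≤√2·
  field squared : x * x ≤ 2 * (y * y)
open _≤√2·_

≰√2·⇒> : ∀ {x y} → ¬ x ≤√2· y → 2 * (y * y) < x * x
≰√2·⇒> x≰√2y = ≰⇒> (x≰√2y ∘ mk≤√2·)

m*m≤n*n⇒m≤n : ∀ {m n} → m * m ≤ n * n → m ≤ n
m*m≤n*n⇒m≤n {m} {n} mm≤nn with m ≤? n
... | yes m≤n = m≤n
... | no m≰n = ⊥-elim (<⇒≱ (*-mono-< (≰⇒> m≰n) (≰⇒> m≰n)) mm≤nn)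

m*m<n*n⇒m<n : ∀ {m n} → m * m < n * n → m < n
m*m<n*n⇒m<n {m} {n} mm<nn with n ≤? m
... | yes n≤m = ⊥-elim (<⇒≱ mm<nn (*-mono-≤ n≤m n≤m))
... | no n≰m = ≰⇒> n≰m

square-+ : ∀ x y → (x + y) * (x + y) ≡ x * x + y * y + 2 * (x * y)
square-+ = solve-∀

square-* : ∀ x y → (x * y) * (x * y) ≡ (x * x) * (y * y)
square-* = solve-∀

double-square-+ : ∀ y₁ y₂ →
  2 * ((y₁ + y₂) * (y₁ + y₂)) ≡ 2 * (y₁ * y₁) + 2 * (y₂ * y₂) + 2 * (2 * (y₁ * y₂))
double-square-+ = solve-∀

double-square-* : ∀ y₁ y₂ → (2 * (y₁ * y₂)) * (2 * (y₁ * y₂)) ≡ (2 * (y₁ * y₁)) * (2 * (y₂ * y₂))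
double-square-* = solve-∀

-- The cross terms compare because their squares are the products of the hypotheses.
≤√2·-+ : ∀ {x₁ y₁ x₂ y₂} → x₁ ≤√2· y₁ → x₂ ≤√2· y₂ → (x₁ + x₂) ≤√2· (y₁ + y₂)
≤√2·-+ {x₁} {y₁} {x₂} {y₂} (mk≤√2· h₁) (mk≤√2· h₂) = mk≤√2· (begin
  (x₁ + x₂) * (x₁ + x₂)                              ≡⟨ square-+ x₁ x₂ ⟩
  x₁ * x₁ + x₂ * x₂ + 2 * (x₁ * x₂)                  ≤⟨ +-mono-≤ (+-mono-≤ h₁ h₂) (*-monoʳ-≤ 2 cross) ⟩
  2 * (y₁ * y₁) + 2 * (y₂ * y₂) + 2 * (2 * (y₁ * y₂)) ≡⟨ double-square-+ y₁ y₂ ⟨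
  2 * ((y₁ + y₂) * (y₁ + y₂))                        ∎)
  where
  open ≤-Reasoning
  cross : x₁ * x₂ ≤ 2 * (y₁ * y₂)
  cross = m*m≤n*n⇒m≤n (begin
    (x₁ * x₂) * (x₁ * x₂)             ≡⟨ square-* x₁ x₂ ⟩
    (x₁ * x₁) * (x₂ * x₂)             ≤⟨ *-mono-≤ h₁ h₂ ⟩
    (2 * (y₁ * y₁)) * (2 * (y₂ * y₂)) ≡⟨ double-square-* y₁ y₂ ⟨
    (2 * (y₁ * y₂)) * (2 * (y₁ * y₂)) ∎)

≰√2·-+ : ∀ {x₁ y₁ x₂ y₂} → ¬ x₁ ≤√2· y₁ → ¬ x₂ ≤√2· y₂ → ¬ (x₁ + x₂) ≤√2· (y₁ + y₂)
≰√2·-+ {x₁} {y₁} {x₂} {y₂} h₁ h₂ (mk≤√2· sum≤) = <⇒≱ (begin-strict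
  2 * ((y₁ + y₂) * (y₁ + y₂))                        ≡⟨ double-square-+ y₁ y₂ ⟩
  2 * (y₁ * y₁) + 2 * (y₂ * y₂) + 2 * (2 * (y₁ * y₂)) <⟨ +-mono-<-≤ (+-mono-< (≰√2·⇒> h₁) (≰√2·⇒> h₂)) (*-monoʳ-≤ 2 (<⇒≤ cross)) ⟩
  x₁ * x₁ + x₂ * x₂ + 2 * (x₁ * x₂)                  ≡⟨ square-+ x₁ x₂ ⟨
  (x₁ + x₂) * (x₁ + x₂)                              ∎) sum≤
  where
  open ≤-Reasoning
  cross : 2 * (y₁ * y₂) < x₁ * x₂
  cross = m*m<n*n⇒m<n (begin-strict
    (2 * (y₁ * y₂)) * (2 * (y₁ * y₂)) ≡⟨ double-square-* y₁ y₂ ⟩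
    (2 * (y₁ * y₁)) * (2 * (y₂ * y₂)) <⟨ *-mono-< (≰√2·⇒> h₁) (≰√2·⇒> h₂) ⟩
    (x₁ * x₁) * (x₂ * x₂)             ≡⟨ square-* x₁ x₂ ⟨
    (x₁ * x₂) * (x₁ * x₂)             ∎)

2∣m*m⇒2∣m : ∀ {m} → 2 ∣ m * m → 2 ∣ m
2∣m*m⇒2∣m {m} = reduce ∘ euclidsLemma m m (from-yes (prime? 2))

double-square-*2 : ∀ h → (h * 2) * (h * 2) ≡ 2 * (2 * (h * h))
double-square-*2 = solve-∀

√2-descent : ∀ x y → x * x ≡ 2 * (y * y) → Σ ℕ λ h → x ≡ h * 2 × y * y ≡ 2 * (h * h)
√2-descent x y xx≡2yy with 2∣m*m⇒2∣m (divides (y * y) (trans xx≡2yy (*-comm 2 (y * y))))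
... | divides h x≡h2 = h , x≡h2 , *-cancelˡ-≡ (y * y) (2 * (h * h)) 2 (begin
  2 * (y * y)       ≡⟨ xx≡2yy ⟨
  x * x             ≡⟨ cong (λ z → z * z) x≡h2 ⟩
  (h * 2) * (h * 2) ≡⟨ double-square-*2 h ⟩
  2 * (2 * (h * h)) ∎)
  where open ≡-Reasoning

-- Infinite descent on y: both x and y are even, and (x/2, y/2) again solves the equation.
√2-irrational : ∀ x y → x * x ≡ 2 * (y * y) → y ≡ 0
√2-irrational x y = <-rec (λ y → ∀ x → x * x ≡ 2 * (y * y) → y ≡ 0) descend y x
  where
  descend : ∀ y → (∀ {g} → g < y → ∀ x → x * x ≡ 2 * (g * g) → g ≡ 0) →
            ∀ x → x * x ≡ 2 * (y * y) → y ≡ 0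
  descend y ih x xx≡2yy = halve-x (√2-descent x y xx≡2yy)
    where
    halve-y : ∀ h → (Σ ℕ λ g → y ≡ g * 2 × h * h ≡ 2 * (g * g)) → y ≡ 0
    halve-y h (zero , y≡0 , _) = y≡0
    halve-y h (suc g , y≡g2 , hh≡2gg) =
      ⊥-elim (0≢1+n (sym (ih (subst (suc g <_) (sym y≡g2) (m<m*n (suc g) 2 ≤-refl)) h hh≡2gg)))
    halve-x : (Σ ℕ λ h → x ≡ h * 2 × y * y ≡ 2 * (h * h)) → y ≡ 0
    halve-x (h , _ , yy≡2hh) = halve-y h (√2-descent y h yy≡2hh)

square-suc-+ : ∀ u v → suc (u + v) * suc (u + v) ≡ suc (suc (u + v) * u + v) + (u + v + u * v + v * v)
square-suc-+ = solve-∀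

archimedean : ∀ {m n} → m < n → ∀ u v → Σ ℕ λ k → (k * k) * m + (k * u + v) < (k * k) * n
archimedean {m} {n} m<n u v = k , (begin-strict
  (k * k) * m + (k * u + v) <⟨ +-monoʳ-< ((k * k) * m) ku+v<kk ⟩
  (k * k) * m + k * k       ≡⟨ trans (*-suc (k * k) m) (+-comm (k * k) _) ⟨
  (k * k) * suc m           ≤⟨ *-monoʳ-≤ (k * k) m<n ⟩
  (k * k) * n               ∎)
  where
  open ≤-Reasoning
  k : ℕ
  k = suc (u + v)
  ku+v<kk : k * u + v < k * k
  ku+v<kk = subst (k * u + v <_) (sym (square-suc-+ u v)) (m≤m+n _ _)

square-+-scaled : ∀ k A D → (k * A + D) * (k * A + D) ≡ (k * k) * (A * A) + (k * (2 * (A * D)) + D * D)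
square-+-scaled = solve-∀

double-square-+-scaled : ∀ k p N →
  2 * ((N + k * p) * (N + k * p)) ≡ (k * k) * (2 * (p * p)) + (k * (4 * (p * N)) + 2 * (N * N))
double-square-+-scaled = solve-∀

double-square-scaled : ∀ k p → 2 * ((k * p) * (k * p)) ≡ (k * k) * (2 * (p * p))
double-square-scaled = solve-∀

trapped-slope-is-√2 : ∀ A p C D N →
  (∀ k → (k * A + C) ≤√2· (N + k * p) × ¬ (k * A + D) ≤√2· (N + k * p)) →
  A * A ≡ 2 * (p * p)
trapped-slope-is-√2 A p C D N trapped with <-cmp (A * A) (2 * (p * p))
... | tri≈ _ AA≡2pp _ = AA≡2pp
... | tri< AA<2pp _ _ = let k , h = archimedean AA<2pp (2 * (A * D)) (D * D) in
  ⊥-elim (proj₂ (trapped k) (mk≤√2· (begin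
    (k * A + D) * (k * A + D)                           ≡⟨ square-+-scaled k A D ⟩
    (k * k) * (A * A) + (k * (2 * (A * D)) + D * D)     ≤⟨ <⇒≤ h ⟩
    (k * k) * (2 * (p * p))                             ≡⟨ double-square-scaled k p ⟨
    2 * ((k * p) * (k * p))                             ≤⟨ *-monoʳ-≤ 2 (*-mono-≤ (m≤n+m _ N) (m≤n+m _ N)) ⟩
    2 * ((N + k * p) * (N + k * p))                     ∎)))
  where open ≤-Reasoning
... | tri> _ _ 2pp<AA = let k , h = archimedean 2pp<AA (4 * (p * N)) (2 * (N * N)) in
  ⊥-elim (<⇒≱ (begin-strict
    2 * ((N + k * p) * (N + k * p))                           ≡⟨ double-square-+-scaled k p N ⟩
    (k * k) * (2 * (p * p)) + (k * (4 * (p * N)) + 2 * (N * N)) <⟨ h ⟩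
    (k * k) * (A * A)                                         ≡⟨ square-* k A ⟨
    (k * A) * (k * A)                                         ≤⟨ *-mono-≤ (m≤m+n (k * A) C) (m≤m+n (k * A) C) ⟩
    (k * A + C) * (k * A + C)                                 ∎) (squared (proj₁ (trapped k))))
  where open ≤-Reasoning

other : Letter → Letter
other a = b
other b = a

letter-or-other : ∀ x z → z ≡ x ⊎ z ≡ other x
letter-or-other a a = inj₁ refl
letter-or-other a b = inj₂ refl
letter-or-other b a = inj₂ refl
letter-or-other b b = inj₁ refl

eqInd-other : ∀ x z → eqInd x z + eqInd (other x) z ≡ 1
eqInd-other a a = refl
eqInd-other a b = refl
eqInd-other b a = refl
eqInd-other b b = refl

eqInd-other-self : ∀ y → eqInd (other y) y ≡ 0
eqInd-other-self a = refl
eqInd-other-self b = refl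

eqInd-self : ∀ y → eqInd y y ≡ 1
eqInd-self a = refl
eqInd-self b = refl

countIn-other : ∀ x w i n → countIn x w i n + countIn (other x) w i n ≡ n
countIn-other x w i zero = refl
countIn-other x w i (suc n) = begin
  countIn x w i n + e + (countIn (other x) w i n + e′)   ≡⟨ interchange (countIn x w i n) e _ e′ ⟩
  countIn x w i n + countIn (other x) w i n + (e + e′)   ≡⟨ cong₂ _+_ (countIn-other x w i n) (eqInd-other x (w (i + n))) ⟩
  n + 1                                                  ≡⟨ +-comm n 1 ⟩
  suc n                                                  ∎
  where
  open ≡-Reasoning
  e e′ : ℕ
  e = eqInd x (w (i + n))
  e′ = eqInd (other x) (w (i + n))

countIn-++ : ∀ x w i m n → countIn x w i m + countIn x w (i + m) n ≡ countIn x w i (m + n)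
countIn-++ x w i m zero rewrite +-identityʳ m = +-identityʳ _
countIn-++ x w i m (suc n) rewrite +-suc m n = begin
  countIn x w i m + (countIn x w (i + m) n + eqInd x (w (i + m + n))) ≡⟨ +-assoc (countIn x w i m) _ _ ⟨
  countIn x w i m + countIn x w (i + m) n + eqInd x (w (i + m + n))   ≡⟨ cong₂ _+_ (countIn-++ x w i m n) (cong (eqInd x ∘ w) (+-assoc i m n)) ⟩
  countIn x w i (m + n) + eqInd x (w (i + (m + n)))                   ∎
  where open ≡-Reasoning

countIn-shift : ∀ x w i j → (∀ t → w (j + t) ≡ w (i + t)) → ∀ n → countIn x w j n ≡ countIn x w i n
countIn-shift x w i j same zero = refl
countIn-shift x w i j same (suc n) = cong₂ _+_ (countIn-shift x w i j same n) (cong (eqInd x) (same n))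

QuasiAdditive : (ℕ → ℕ) → Set
QuasiAdditive f = ∀ m n → f m + f n ≤ f (m + n) × f (m + n) ≤ suc (f m + f n)

∣m-n∣≤1 : ∀ {m n} → m ≤ suc n → n ≤ suc m → ∣ m - n ∣ ≤ 1
∣m-n∣≤1 {zero} {zero} _ _ = z≤n
∣m-n∣≤1 {zero} {suc zero} _ _ = ≤-refl
∣m-n∣≤1 {zero} {suc (suc n)} _ (s≤s ())
∣m-n∣≤1 {suc zero} {zero} _ _ = ≤-refl
∣m-n∣≤1 {suc (suc m)} {zero} (s≤s ()) _
∣m-n∣≤1 {suc m} {suc n} (s≤s m≤1+n) (s≤s n≤1+m) = ∣m-n∣≤1 m≤1+n n≤1+m

complement-≤-suc : ∀ {m m′ n n′} → m + m′ ≡ n + n′ → n ≤ suc m → m′ ≤ suc n′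
complement-≤-suc {m} {m′} {n} {n′} sums n≤1+m = +-cancelˡ-≤ m m′ (suc n′) (begin
  m + m′       ≡⟨ sums ⟩
  n + n′       ≤⟨ +-monoˡ-≤ n′ n≤1+m ⟩
  suc m + n′   ≡⟨ +-suc m n′ ⟨
  m + suc n′   ∎)
  where open ≤-Reasoning

-- Every factor of length n contains f n or f n + 1 copies of x.
quasiAdditive⇒balanced : ∀ x w f → (∀ n → countIn x w 0 n ≡ f n) → QuasiAdditive f → Balanced w
quasiAdditive⇒balanced x w f prefixCount quasiAdditive z i j n = ∣m-n∣≤1 (close z i j) (close z j i)
  where
  open ≤-Reasoning
  split : ∀ i → f i + countIn x w i n ≡ f (i + n)
  split i = begin-equality
    f i + countIn x w i n                ≡⟨ cong (_+ countIn x w i n) (prefixCount i) ⟨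
    countIn x w 0 i + countIn x w i n    ≡⟨ countIn-++ x w 0 i n ⟩
    countIn x w 0 (i + n)                ≡⟨ prefixCount (i + n) ⟩
    f (i + n)                            ∎
  lower : ∀ i → f n ≤ countIn x w i n
  lower i = +-cancelˡ-≤ (f i) (f n) _ (begin
    f i + f n                ≤⟨ proj₁ (quasiAdditive i n) ⟩
    f (i + n)                ≡⟨ split i ⟨
    f i + countIn x w i n    ∎)
  upper : ∀ i → countIn x w i n ≤ suc (f n)
  upper i = +-cancelˡ-≤ (f i) _ (suc (f n)) (begin
    f i + countIn x w i n    ≡⟨ split i ⟩
    f (i + n)                ≤⟨ proj₂ (quasiAdditive i n) ⟩
    suc (f i + f n)          ≡⟨ +-suc (f i) (f n) ⟨
    f i + suc (f n)          ∎)
  close-x : ∀ i j → countIn x w i n ≤ suc (countIn x w j n)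
  close-x i j = ≤-trans (upper i) (s≤s (lower j))
  close : ∀ z i j → countIn z w i n ≤ suc (countIn z w j n)
  close z i j with letter-or-other x z
  ... | inj₁ refl = close-x i j
  ... | inj₂ refl = complement-≤-suc (trans (countIn-other x w i n) (sym (countIn-other x w j n))) (close-x j i)

countIn-periodic : ∀ x w p N → (∀ i → N ≤ i → w (i + p) ≡ w i) →
  ∀ k → countIn x w N (k * p) ≡ k * countIn x w N p
countIn-periodic x w p N periodic zero = refl
countIn-periodic x w p N periodic (suc k) = begin
  countIn x w N (p + k * p)                        ≡⟨ countIn-++ x w N p (k * p) ⟨
  countIn x w N p + countIn x w (N + p) (k * p)    ≡⟨ cong (countIn x w N p +_) (countIn-shift x w N (N + p) shifted (k * p)) ⟩
  countIn x w N p + countIn x w N (k * p)          ≡⟨ cong (countIn x w N p +_) (countIn-periodic x w p N periodic k) ⟩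
  countIn x w N p + k * countIn x w N p            ∎
  where
  open ≡-Reasoning
  shifted : ∀ t → w (N + p + t) ≡ w (N + t)
  shifted t = trans (cong w (xy∙z≈xz∙y N p t)) (periodic (N + t) (m≤m+n N t))

ultimatelyPeriodic⇒prefixCount-linear : ∀ x w → UltimatelyPeriodic w →
  Σ ℕ λ p → 0 < p × Σ ℕ λ N → ∀ k → countIn x w 0 (N + k * p) ≡ countIn x w 0 N + k * countIn x w N p
ultimatelyPeriodic⇒prefixCount-linear x w (p , p>0 , N , periodic) = p , p>0 , N , λ k → trans
  (sym (countIn-++ x w 0 N (k * p))) (cong (countIn x w 0 N +_) (countIn-periodic x w p N periodic k))

ZeroOneSteps : (ℕ → ℕ) → Set
ZeroOneSteps f = ∀ n → f (suc n) ≡ f n ⊎ f (suc n) ≡ suc (f n)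

stepWord : Letter → (ℕ → ℕ) → InfWord
stepWord y f n with f (suc n) ≟ f n
... | yes _ = y
... | no _ = other y

stepWord-flat : ∀ y f n → f (suc n) ≡ f n → stepWord y f n ≡ y
stepWord-flat y f n flat with f (suc n) ≟ f n
... | yes _ = refl
... | no notFlat = ⊥-elim (notFlat flat)

stepWord-increment : ∀ y f → ZeroOneSteps f → ∀ n → f n + eqInd (other y) (stepWord y f n) ≡ f (suc n)
stepWord-increment y f steps n with f (suc n) ≟ f n | steps n
... | yes flat | _ = trans (cong (f n +_) (eqInd-other-self y)) (trans (+-identityʳ (f n)) (sym flat))
... | no notFlat | inj₁ flat = ⊥-elim (notFlat flat)
... | no _ | inj₂ up = trans (cong (f n +_) (eqInd-self (other y))) (trans (+-comm (f n) 1) (sym up))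

stepWord-prefixCount : ∀ y f → f 0 ≡ 0 → ZeroOneSteps f → ∀ n → countIn (other y) (stepWord y f) 0 n ≡ f n
stepWord-prefixCount y f f0≡0 steps zero = sym f0≡0
stepWord-prefixCount y f f0≡0 steps (suc n) =
  trans (cong (_+ eqInd (other y) (stepWord y f n)) (stepWord-prefixCount y f f0≡0 steps n)) (stepWord-increment y f steps n)

stepWord-sturmian : ∀ y f → f 0 ≡ 0 → ZeroOneSteps f → QuasiAdditive f →
  (∀ N p q → 0 < p → ¬ (∀ k → f (N + k * p) ≡ f N + k * q)) → Sturmian (stepWord y f)
stepWord-sturmian y f f0≡0 steps quasiAdditive nonlinear =
  quasiAdditive⇒balanced (other y) w f prefixCount quasiAdditive , aperiodic
  where
  w : InfWord
  w = stepWord y f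
  prefixCount : ∀ n → countIn (other y) w 0 n ≡ f n
  prefixCount = stepWord-prefixCount y f f0≡0 steps
  aperiodic : ¬ UltimatelyPeriodic w
  aperiodic up with ultimatelyPeriodic⇒prefixCount-linear (other y) w up
  ... | p , p>0 , N , linear = nonlinear N p (countIn (other y) w N p) p>0 λ k → begin
    f (N + k * p)                                        ≡⟨ prefixCount (N + k * p) ⟨
    countIn (other y) w 0 (N + k * p)                    ≡⟨ linear k ⟩
    countIn (other y) w 0 N + k * countIn (other y) w N p ≡⟨ cong (_+ k * countIn (other y) w N p) (prefixCount N) ⟩
    f N + k * countIn (other y) w N p                    ∎
    where open ≡-Reasoning

affine-+ : ∀ c m₁ m₂ n₁ n₂ → c * (m₁ + m₂) + (n₁ + n₂) ≡ (c * m₁ + n₁) + (c * m₂ + n₂)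
affine-+ = solve-∀

affine-progression : ∀ c f q N p k → c * (f + k * q) + (N + k * p) ≡ k * (c * q + p) + (c * f + N)
affine-progression = solve-∀

affine-progression-suc : ∀ c f q N p k →
  c * suc (f + k * q) + (N + k * p) ≡ k * (c * q + p) + (c * f + N + c)
affine-progression-suc = solve-∀

square-suc-double : ∀ n → (suc n + n) * (suc n + n) ≡ suc (2 * (n * n) + (2 * (n * n) + 4 * n))
square-suc-double = solve-∀

module Root2Floor (M : ℕ) where

  -- The lattice point (n, m) lies on or below the line m = (√2 - 1) n / (M + 1).
  Below : ℕ → ℕ → Set
  Below m n = (suc M * m + n) ≤√2· n

  Below? : ∀ m n → Dec (Below m n)
  Below? m n = map′ mk≤√2· squared (_ ≤? _)

  Below-+ : ∀ {m₁ m₂ n₁ n₂} → Below m₁ n₁ → Below m₂ n₂ → Below (m₁ + m₂) (n₁ + n₂)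
  Below-+ {m₁} {m₂} {n₁} {n₂} h₁ h₂ =
    subst (_≤√2· (n₁ + n₂)) (sym (affine-+ (suc M) m₁ m₂ n₁ n₂)) (≤√2·-+ h₁ h₂)

  ¬Below-+ : ∀ {m₁ m₂ n₁ n₂} → ¬ Below m₁ n₁ → ¬ Below m₂ n₂ → ¬ Below (m₁ + m₂) (n₁ + n₂)
  ¬Below-+ {m₁} {m₂} {n₁} {n₂} h₁ h₂ =
    subst (λ x → ¬ x ≤√2· (n₁ + n₂)) (sym (affine-+ (suc M) m₁ m₂ n₁ n₂)) (≰√2·-+ h₁ h₂)

  Below-antitone : ∀ {m m′ n} → m′ ≤ m → Below m n → Below m′ n
  Below-antitone {m} {m′} {n} m′≤m (mk≤√2· below) = mk≤√2· (≤-trans (*-mono-≤ shift shift) below)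
    where
    shift : suc M * m′ + n ≤ suc M * m + n
    shift = +-monoˡ-≤ n (*-monoʳ-≤ (suc M) m′≤m)

  Below-0 : ∀ n → Below 0 n
  Below-0 n rewrite *-zeroʳ M = mk≤√2· (m≤m+n (n * n) (n * n + 0))

  ¬Below-1 : ∀ {n} → n ≤ M → ¬ Below 1 n
  ¬Below-1 {n} n≤M (mk≤√2· below) = <⇒≱ (begin-strict
    2 * (n * n)                      <⟨ s≤s (m≤m+n _ _) ⟩
    suc (2 * (n * n) + (2 * (n * n) + 4 * n)) ≡⟨ square-suc-double n ⟨
    (suc n + n) * (suc n + n)        ≤⟨ *-mono-≤ lower lower ⟩
    (suc M * 1 + n) * (suc M * 1 + n) ∎) below
    where
    open ≤-Reasoning
    lower : suc n + n ≤ suc M * 1 + n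
    lower = +-monoˡ-≤ n (subst (suc n ≤_) (sym (*-identityʳ (suc M))) (s≤s n≤M))

  ¬Below-1-1 : ¬ Below 1 1
  ¬Below-1-1 (mk≤√2· below) = <⇒≱ (≤-trans (s≤s (s≤s (s≤s z≤n))) (*-mono-≤ two≤ two≤)) below
    where
    two≤ : 2 ≤ suc M * 1 + 1
    two≤ = s≤s (m≤n+m 1 (M * 1))

  floor : ℕ → ℕ
  floor zero = 0
  floor (suc n) with Below? (suc (floor n)) (suc n)
  ... | yes _ = suc (floor n)
  ... | no _ = floor n

  floor-spec : ∀ n → Below (floor n) n × ¬ Below (suc (floor n)) n
  floor-spec zero = Below-0 0 , ¬Below-1 z≤n
  floor-spec (suc n) with Below? (suc (floor n)) (suc n) | floor-spec n
  ... | yes below | _ , above = below , ¬Below-+ {1} ¬Below-1-1 above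
  ... | no above | below , _ = Below-+ (Below-0 1) below , above

  floor-steps : ZeroOneSteps floor
  floor-steps n with Below? (suc (floor n)) (suc n)
  ... | yes _ = inj₂ refl
  ... | no _ = inj₁ refl

  floor-maximal : ∀ {m n} → Below m n → m ≤ floor n
  floor-maximal {m} {n} below with m ≤? floor n
  ... | yes m≤floor = m≤floor
  ... | no m≰floor = ⊥-elim (proj₂ (floor-spec n) (Below-antitone (≰⇒> m≰floor) below))

  floor-minimal : ∀ {m n} → ¬ Below m n → floor n < m
  floor-minimal {m} {n} above with m ≤? floor n
  ... | yes m≤floor = ⊥-elim (above (Below-antitone m≤floor (proj₁ (floor-spec n))))
  ... | no m≰floor = ≰⇒> m≰floor

  floor-quasiAdditive : QuasiAdditive floor
  floor-quasiAdditive m n =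
    floor-maximal (Below-+ (proj₁ (floor-spec m)) (proj₁ (floor-spec n))) ,
    subst (floor (m + n) ≤_) (+-suc (floor m) (floor n))
      (≤-pred (floor-minimal (¬Below-+ (proj₂ (floor-spec m)) (proj₂ (floor-spec n)))))

  floor-small : ∀ {n} → n ≤ M → floor n ≡ 0
  floor-small n≤M = n<1⇒n≡0 (floor-minimal (¬Below-1 n≤M))

  floor-nonlinear : ∀ N p q → 0 < p → ¬ (∀ k → floor (N + k * p) ≡ floor N + k * q)
  floor-nonlinear N p q p>0 linear = <⇒≢ p>0 (sym (√2-irrational A p
    (trapped-slope-is-√2 A p (suc M * floor N + N) (suc M * floor N + N + suc M) N trapped)))
    where
    A : ℕ
    A = suc M * q + p
    trapped : ∀ k → (k * A + (suc M * floor N + N)) ≤√2· (N + k * p) ×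
                    ¬ (k * A + (suc M * floor N + N + suc M)) ≤√2· (N + k * p)
    trapped k with subst (λ m → Below m (N + k * p) × ¬ Below (suc m) (N + k * p)) (linear k) (floor-spec (N + k * p))
    ... | below , above =
      subst (_≤√2· (N + k * p)) (affine-progression (suc M) (floor N) q N p k) below ,
      subst (λ x → ¬ x ≤√2· (N + k * p)) (affine-progression-suc (suc M) (floor N) q N p k) above

sturmian-with-run : ∀ M y → Σ InfWord λ w → Sturmian w × (∀ n → n < M → w n ≡ y)
sturmian-with-run M y =
  stepWord y floor ,
  stepWord-sturmian y floor refl floor-steps floor-quasiAdditive floor-nonlinear ,
  λ n n<M → stepWord-flat y floor n (trans (floor-small n<M) (sym (floor-small (<⇒≤ n<M))))
  where open Root2Floor M

constant-ultimatelyPeriodic : ∀ y → UltimatelyPeriodic (λ _ → y)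
constant-ultimatelyPeriodic y = 1 , s≤s z≤n , 0 , λ _ _ → refl

imageLength-bound : ∀ {k} (S : Fin k → Morphism) → Σ ℕ λ B → ∀ j x → length (S j x) ≤ B
imageLength-bound {zero} S = 0 , λ ()
imageLength-bound {suc k} S with imageLength-bound (S ∘ suc)
... | B , bounded = length (S zero a) ⊔ length (S zero b) ⊔ B , bound
  where
  bound : ∀ j x → length (S j x) ≤ length (S zero a) ⊔ length (S zero b) ⊔ B
  bound zero a = ≤-trans (m≤m⊔n _ _) (m≤m⊔n _ B)
  bound zero b = ≤-trans (m≤n⊔m _ _) (m≤m⊔n _ B)
  bound (suc j) x = ≤-trans (bounded j x) (m≤n⊔m _ B)

first-image-isPrefix : ∀ σ v w → IsImage σ v w → IsPrefix (σ (v 0)) w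
first-image-isPrefix σ v w image = subst (λ u → IsPrefix u w) (++-identityʳ (σ (v 0))) (image 1)

isPrefix-all : ∀ u w y → IsPrefix u w → (∀ n → n < length u → w n ≡ y) → All (_≡ y) u
isPrefix-all [] w y prefix constant = []
isPrefix-all (x ∷ u) w y prefix constant =
  trans (prefix zero) (constant 0 (s≤s z≤n)) ∷
  isPrefix-all u (w ∘ suc) y (prefix ∘ suc) (λ n n<∣u∣ → constant (suc n) (s≤s n<∣u∣))

all-isPrefix-constant : ∀ u y → All (_≡ y) u → IsPrefix u (λ _ → y)
all-isPrefix-constant (x ∷ u) y (x≡y ∷ _) zero = x≡y
all-isPrefix-constant (x ∷ u) y (_ ∷ u≡y) (suc i) = all-isPrefix-constant u y u≡y i

constant-image : ∀ σ x y → All (_≡ y) (σ x) → IsImage σ (λ _ → x) (λ _ → y)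
constant-image σ x y σx≡y k = all-isPrefix-constant _ y (powers k)
  where
  powers : ∀ k → All (_≡ y) (applyW σ (prefixOf (λ _ → x) k))
  powers zero = []
  powers (suc k) = ++⁺ σx≡y (powers k)

Collapses : {k : ℕ} → (Fin k → Morphism) → Letter → Set
Collapses {k} S y = Σ (Fin k) λ j → Σ Letter λ x → All (_≡ y) (S j x)

-- σ (w′ 0) is a prefix of w no longer than its initial run of y.
collapses-if-run∈Stab : ∀ {k} (S : Fin k → Morphism) B → (∀ j x → length (S j x) ≤ B) →
  ∀ w y → (∀ n → n < B → w n ≡ y) → Stab S w → Collapses S y
collapses-if-run∈Stab S B bounded w y run (c , ws , ws0≡w , images) =
  c 0 , ws 1 0 , isPrefix-all (S (c 0) (ws 1 0)) (ws 0) y (first-image-isPrefix (S (c 0)) (ws 1) (ws 0) (images 0))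
    λ n n<∣σx∣ → trans (ws0≡w n) (run n (≤-trans n<∣σx∣ (bounded (c 0) (ws 1 0))))

collapses-if-sturmian⊆Stab : ∀ {k} (S : Fin k → Morphism) → (∀ w → Sturmian w → Stab S w) → ∀ y → Collapses S y
collapses-if-sturmian⊆Stab S sturmian⊆Stab y =
  collapses-if-run∈Stab S B bounded w y run (sturmian⊆Stab w sturmian)
  where
  B : ℕ
  B = proj₁ (imageLength-bound S)
  bounded : ∀ j x → length (S j x) ≤ B
  bounded = proj₂ (imageLength-bound S)
  w : InfWord
  w = proj₁ (sturmian-with-run B y)
  sturmian : Sturmian w
  sturmian = proj₁ (proj₂ (sturmian-with-run B y))
  run : ∀ n → n < B → w n ≡ y
  run = proj₂ (proj₂ (sturmian-with-run B y))

constant-in-Stab : ∀ {k} (S : Fin k → Morphism) → (∀ y → Collapses S y) → ∀ y → Stab S (λ _ → y)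
constant-in-Stab S collapses y = proj₁ ∘ collapses ∘ letters , (λ n _ → letters n) , (λ _ → refl) ,
  λ n → constant-image (S (proj₁ (collapses (letters n)))) (letters (suc n)) (letters n)
          (proj₂ (proj₂ (collapses (letters n))))
  where
  letters : ℕ → Letter
  letters zero = y
  letters (suc n) = proj₁ (proj₂ (collapses (letters n)))

-- The argument never uses that the morphisms are nonerasing.
proposition5p2 : ¬ (Σ ℕ λ k → Σ (Fin k → Morphism) λ S →
                     (∀ j → Nonerasing (S j)) ×
                     (∀ (w : InfWord) → Sturmian w ⇔ Stab S w))
proposition5p2 (k , S , _ , sturmian⇔Stab) =
  proj₂ (Equivalence.from (sturmian⇔Stab aᵒ) aᵒ∈Stab) (constant-ultimatelyPeriodic a)
  where
  aᵒ : InfWord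
  aᵒ _ = a
  aᵒ∈Stab : Stab S aᵒ
  aᵒ∈Stab = constant-in-Stab S
    (collapses-if-sturmian⊆Stab S (λ w → Equivalence.to (sturmian⇔Stab w))) a
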